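{- Let $H$ be the set of harmonic numbers and $\mathcal{M}$ the set of Mersenne primes. Then the $abc$-conjecture is true on $H\cup\mathcal{M}$: for every $\varepsilon>0$ there are only finitely many triples $(a,b,c)$ of coprime positive integers with $a,b,c\in H\cup\mathcal{M}$, $a+b=c$ and $c>\operatorname{rad}(abc)^{1+\varepsilon}$.
   Context: A harmonic number is a positive integer of the form $2^a3^b$ with $a,b\ge 0$ integers (so $1$ is harmonic). A Mersenne prime is a prime of the form $2^p-1$. For a positive integer $n$, $\operatorname{rad}(n)$ is the product of the distinct primes dividing $n$. Positive integers $a,b,c$ are coprime if they have no common prime factor.
   Formalization: The parameter ε ranges over the positive rationals. -}

module Defs where

open import Data.Nat using (ℕ; zero; suc; _+_; _*_; _∸_; _^_; _<_)
open import Data.Nat.Divisibility using (_∣_; _∣?_)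
open import Data.Nat.Primality using (Prime; prime?)
open import Data.List using (List; filter; upTo)
open import Data.Nat.ListAction using (product)
open import Data.Product using (Σ; ∃; _×_; _,_)
open import Data.Sum using (_⊎_)
open import Data.Empty using (⊥)
open import Relation.Nullary.Decidable using (_×-dec_)
open import Relation.Binary.PropositionalEquality using (_≡_)

Harmonic : ℕ → Set
Harmonic n = Σ ℕ λ a → Σ ℕ λ b → n ≡ 2 ^ a * 3 ^ b

MersennePrime : ℕ → Set
MersennePrime n = Prime n × (Σ ℕ λ p → n ≡ 2 ^ p ∸ 1)

InHM : ℕ → Set
InHM n = Harmonic n ⊎ MersennePrime n

-- rad n: product of the distinct primes dividing n (all such primes are ≤ n for n ≥ 1)
rad : ℕ → ℕ
rad n = product (filter (λ p → prime? p ×-dec (p ∣? n)) (upTo (suc n)))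

Coprime3 : ℕ → ℕ → ℕ → Set
Coprime3 a b c = (p : ℕ) → Prime p → p ∣ a → p ∣ b → p ∣ c → ⊥

-- c > rad(abc)^(1+ε) with ε = e / d (e, d ≥ 1), written without reals:
-- rad(abc)^(d+e) < c^d
AbcExceptional : ℕ → ℕ → ℕ → ℕ → ℕ → Set
AbcExceptional e d a b c = rad (a * b * c) ^ (d + e) < c ^ d

module Submission where

-- We show that every coprime triple a + b = c in H ∪ M has c ≤ 16 or
-- c ≤ rad(abc) (small-or-radical); in the second case c ≤ rad(abc)^(1+ε),
-- so every exceptional triple is among the finitely many (a, b, a + b) with
-- a, b ≤ 16. Writing a Mersenne prime M ≠ 3 as 2^(3+p) - 1 (3 is harmonic):
--   * c prime, or a, b both primes: c ≤ rad(abc) directly;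
--   * a, b, c harmonic: pairwise coprimality forces the shapes 1 + 2^k = 3^y,
--     1 + 3^j = 2^x or c = 1, hence c ≤ 16;
--   * M + b = c with b, c harmonic: c = M + 1, M + 2, M + 4 gives c ≤ 2M or 3M
--     ≤ rad(abc); otherwise c ≤ 16 or an exponential equation in powers of 2 and 3.
-- The exponential equations are refuted modulo a fixed m: powers are
-- periodic modulo m, so finitely many cases remain, checked by evaluation.

open import Defs
open import Level using (0ℓ)
open import Data.Bool using (T)
open import Data.Empty using (⊥; ⊥-elim)
open import Data.Sum using (_⊎_; inj₁; inj₂; map₂; [_,_]′)
open import Data.Product using (Σ; _×_; _,_; proj₁)
open import Data.Nat
open import Data.Nat.Properties
open import Data.Nat.DivMod
open import Data.Nat.Divisibility
open import Data.Nat.Primality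
open import Data.Nat.Coprimality as Coprime using (Coprime; coprime-divisor)
open import Data.Nat.ListAction.Properties using (∈⇒∣product)
open import Data.Nat.Tactic.RingSolver using (solve-∀)
open import Data.List using (List; upTo; filter; cartesianProductWith)
open import Data.List.Relation.Unary.All as All using (All; all?; lookup)
open import Data.List.Relation.Unary.All.Properties using (all-filter)
open import Data.List.Membership.Propositional using (_∈_)
open import Data.List.Membership.Propositional.Properties
  using (∈-upTo⁺; ∈-filter⁺; ∈-cartesianProductWith⁺)
open import Relation.Unary using (Decidable)
open import Relation.Nullary using (¬_; Dec; contradiction)
open import Relation.Nullary.Decidable using (_×-dec_; from-yes; ¬?)
open import Relation.Binary.Bundles using (Setoid)
open import Relation.Binary.PropositionalEquality
import Relation.Binary.Reasoning.Setoid as SetoidReasoning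

-- Congruence modulo m, via remainders. It is a record so that both sides
-- can be recovered by unification (unlike the reducing expression x % m).
infix 4 _≡_⟨mod_⟩
record _≡_⟨mod_⟩ (x y m : ℕ) .{{_ : NonZero m}} : Set where
  constructor same-residue
  field residue : x % m ≡ y % m
open _≡_⟨mod_⟩ public

module _ {m : ℕ} .{{_ : NonZero m}} where

  ≡-mod-refl : ∀ {x} → x ≡ x ⟨mod m ⟩
  ≡-mod-refl = same-residue refl

  ≡⇒≡-mod : ∀ {x y} → x ≡ y → x ≡ y ⟨mod m ⟩
  ≡⇒≡-mod x≡y = same-residue (cong (_% m) x≡y)

  mod-setoid : Setoid 0ℓ 0ℓ
  mod-setoid = record
    { Carrier = ℕ
    ; _≈_ = λ x y → x ≡ y ⟨mod m ⟩
    ; isEquivalence = record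
      { refl = ≡-mod-refl
      ; sym = λ x≡y → same-residue (sym (residue x≡y))
      ; trans = λ x≡y y≡z → same-residue (trans (residue x≡y) (residue y≡z))
      }
    }

  +-cong-mod : ∀ {x x′ y y′} → x ≡ x′ ⟨mod m ⟩ → y ≡ y′ ⟨mod m ⟩ → x + y ≡ x′ + y′ ⟨mod m ⟩
  +-cong-mod {x} {x′} {y} {y′} (same-residue x≡x′) (same-residue y≡y′) = same-residue (begin
    (x + y) % m             ≡⟨ %-distribˡ-+ x y m ⟩
    (x % m + y % m) % m     ≡⟨ cong₂ (λ u v → (u + v) % m) x≡x′ y≡y′ ⟩
    (x′ % m + y′ % m) % m   ≡⟨ %-distribˡ-+ x′ y′ m ⟨
    (x′ + y′) % m           ∎)
    where open ≡-Reasoning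

  *-cong-mod : ∀ {x x′ y y′} → x ≡ x′ ⟨mod m ⟩ → y ≡ y′ ⟨mod m ⟩ → x * y ≡ x′ * y′ ⟨mod m ⟩
  *-cong-mod {x} {x′} {y} {y′} (same-residue x≡x′) (same-residue y≡y′) = same-residue (begin
    (x * y) % m             ≡⟨ %-distribˡ-* x y m ⟩
    (x % m * (y % m)) % m   ≡⟨ cong₂ (λ u v → (u * v) % m) x≡x′ y≡y′ ⟩
    (x′ % m * (y′ % m)) % m ≡⟨ %-distribˡ-* x′ y′ m ⟨
    (x′ * y′) % m           ∎)
    where open ≡-Reasoning

^-periodic : ∀ b t per m .{{_ : NonZero per}} .{{_ : NonZero m}} →
             b ^ (t + per) ≡ b ^ t ⟨mod m ⟩ →
             ∀ n → b ^ (t + n) ≡ b ^ (t + n % per) ⟨mod m ⟩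
^-periodic b t per m period n = begin
  b ^ (t + n)                       ≡⟨ cong (λ k → b ^ (t + k)) (m≡m%n+[m/n]*n n per) ⟩
  b ^ (t + (n % per + n / per * per)) ≈⟨ drop (n / per) (n % per) ⟩
  b ^ (t + n % per)                 ∎
  where
  open SetoidReasoning mod-setoid

  regroup : ∀ t r per s → t + (r + (per + s)) ≡ (t + per) + (r + s)
  regroup = solve-∀

  drop : ∀ q r → b ^ (t + (r + q * per)) ≡ b ^ (t + r) ⟨mod m ⟩
  drop zero r = ≡⇒≡-mod (cong (λ k → b ^ (t + k)) (+-identityʳ r))
  drop (suc q) r = begin
    b ^ (t + (r + (per + q * per)))   ≡⟨ cong (b ^_) (regroup t r per (q * per)) ⟩
    b ^ ((t + per) + (r + q * per))   ≡⟨ ^-distribˡ-+-* b (t + per) (r + q * per) ⟩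
    b ^ (t + per) * b ^ (r + q * per) ≈⟨ *-cong-mod period ≡-mod-refl ⟩
    b ^ t * b ^ (r + q * per)         ≡⟨ ^-distribˡ-+-* b t (r + q * per) ⟨
    b ^ (t + (r + q * per))           ≈⟨ drop q r ⟩
    b ^ (t + r)                       ∎

Below : ℕ → (ℕ → Set) → Set
Below n P = All P (upTo n)

below? : ∀ {P : ℕ → Set} → Decidable P → ∀ n → Dec (Below n P)
below? P? n = all? P? (upTo n)

at : ∀ {n} {P : ℕ → Set} → Below n P → ∀ {u} → u < n → P u
at all u<n = lookup all (∈-upTo⁺ u<n)

1+2^k≢3^[3+y] : ∀ k y → 1 + 2 ^ k ≢ 3 ^ (3 + y)
1+2^k≢3^[3+y] k y eq = at (at residues (m%n<n k 18)) (m%n<n y 18) (residue reduced)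
  where
  residues : Below 18 λ u → Below 18 λ v → (1 + 2 ^ u) % 513 ≢ 3 ^ (3 + v) % 513
  residues = from-yes (below? (λ u → below? (λ v → ¬? ((1 + 2 ^ u) % 513 ≟ 3 ^ (3 + v) % 513)) 18) 18)
  open SetoidReasoning (mod-setoid {513})
  reduced : 1 + 2 ^ (k % 18) ≡ 3 ^ (3 + y % 18) ⟨mod 513 ⟩
  reduced = begin
    1 + 2 ^ (k % 18)  ≈⟨ +-cong-mod ≡-mod-refl (^-periodic 2 0 18 513 (same-residue refl) k) ⟨
    1 + 2 ^ k         ≡⟨ eq ⟩
    3 ^ (3 + y)       ≈⟨ ^-periodic 3 3 18 513 (same-residue refl) y ⟩
    3 ^ (3 + y % 18)  ∎

1+3^j≢2^[3+x] : ∀ j x → 1 + 3 ^ j ≢ 2 ^ (3 + x)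
1+3^j≢2^[3+x] j x eq = at (at residues (m%n<n j 2)) (m%n<n x 1) (residue reduced)
  where
  residues : Below 2 λ u → Below 1 λ v → (1 + 3 ^ u) % 8 ≢ 2 ^ (3 + v) % 8
  residues = from-yes (below? (λ u → below? (λ v → ¬? ((1 + 3 ^ u) % 8 ≟ 2 ^ (3 + v) % 8)) 1) 2)
  open SetoidReasoning (mod-setoid {8})
  reduced : 1 + 3 ^ (j % 2) ≡ 2 ^ (3 + x % 1) ⟨mod 8 ⟩
  reduced = begin
    1 + 3 ^ (j % 2)  ≈⟨ +-cong-mod ≡-mod-refl (^-periodic 3 0 2 8 (same-residue refl) j) ⟨
    1 + 3 ^ j        ≡⟨ eq ⟩
    2 ^ (3 + x)      ≈⟨ ^-periodic 2 3 1 8 (same-residue refl) x ⟩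
    2 ^ (3 + x % 1)  ∎

2^[3+p]+2^[3+k]≢3^y+1 : ∀ p k y → 2 ^ (3 + p) + 2 ^ (3 + k) ≢ 3 ^ y + 1
2^[3+p]+2^[3+k]≢3^y+1 p k y eq =
  at (at (at residues (m%n<n p 1)) (m%n<n k 1)) (m%n<n y 2) (residue reduced)
  where
  residues : Below 1 λ u → Below 1 λ w → Below 2 λ v →
             (2 ^ (3 + u) + 2 ^ (3 + w)) % 8 ≢ (3 ^ v + 1) % 8
  residues = from-yes (below? (λ u → below? (λ w → below? (λ v →
    ¬? ((2 ^ (3 + u) + 2 ^ (3 + w)) % 8 ≟ (3 ^ v + 1) % 8)) 2) 1) 1)
  open SetoidReasoning (mod-setoid {8})
  reduced : 2 ^ (3 + p % 1) + 2 ^ (3 + k % 1) ≡ 3 ^ (y % 2) + 1 ⟨mod 8 ⟩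
  reduced = begin
    2 ^ (3 + p % 1) + 2 ^ (3 + k % 1)
      ≈⟨ +-cong-mod (^-periodic 2 3 1 8 (same-residue refl) p) (^-periodic 2 3 1 8 (same-residue refl) k) ⟨
    2 ^ (3 + p) + 2 ^ (3 + k)  ≡⟨ eq ⟩
    3 ^ y + 1                  ≈⟨ +-cong-mod (^-periodic 3 0 2 8 (same-residue refl) y) ≡-mod-refl ⟩
    3 ^ (y % 2) + 1            ∎

8+3^j≢2^[5+x]+1 : ∀ j x → 8 + 3 ^ j ≢ 2 ^ (5 + x) + 1
8+3^j≢2^[5+x]+1 j x eq = at (at residues (m%n<n j 16)) (m%n<n x 8) (residue reduced)
  where
  residues : Below 16 λ u → Below 8 λ v → (8 + 3 ^ u) % 2720 ≢ (2 ^ (5 + v) + 1) % 2720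
  residues = from-yes (below? (λ u → below? (λ v →
    ¬? ((8 + 3 ^ u) % 2720 ≟ (2 ^ (5 + v) + 1) % 2720)) 8) 16)
  open SetoidReasoning (mod-setoid {2720})
  reduced : 8 + 3 ^ (j % 16) ≡ 2 ^ (5 + x % 8) + 1 ⟨mod 2720 ⟩
  reduced = begin
    8 + 3 ^ (j % 16)     ≈⟨ +-cong-mod ≡-mod-refl (^-periodic 3 0 16 2720 (same-residue refl) j) ⟨
    8 + 3 ^ j            ≡⟨ eq ⟩
    2 ^ (5 + x) + 1      ≈⟨ +-cong-mod (^-periodic 2 5 8 2720 (same-residue refl) x) ≡-mod-refl ⟩
    2 ^ (5 + x % 8) + 1  ∎

2^[4+p]+3^[1+j]≢2^[5+x]+1 : ∀ p j x → 2 ^ (4 + p) + 3 ^ (1 + j) ≢ 2 ^ (5 + x) + 1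
2^[4+p]+3^[1+j]≢2^[5+x]+1 p j x eq =
  at (at (at residues (m%n<n p 4)) (m%n<n j 4)) (m%n<n x 4) (residue reduced)
  where
  residues : Below 4 λ u → Below 4 λ w → Below 4 λ v →
             (2 ^ (4 + u) + 3 ^ (1 + w)) % 240 ≢ (2 ^ (5 + v) + 1) % 240
  residues = from-yes (below? (λ u → below? (λ w → below? (λ v →
    ¬? ((2 ^ (4 + u) + 3 ^ (1 + w)) % 240 ≟ (2 ^ (5 + v) + 1) % 240)) 4) 4) 4)
  open SetoidReasoning (mod-setoid {240})
  reduced : 2 ^ (4 + p % 4) + 3 ^ (1 + j % 4) ≡ 2 ^ (5 + x % 4) + 1 ⟨mod 240 ⟩
  reduced = begin
    2 ^ (4 + p % 4) + 3 ^ (1 + j % 4)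
      ≈⟨ +-cong-mod (^-periodic 2 4 4 240 (same-residue refl) p) (^-periodic 3 1 4 240 (same-residue refl) j) ⟨
    2 ^ (4 + p) + 3 ^ (1 + j)  ≡⟨ eq ⟩
    2 ^ (5 + x) + 1            ≈⟨ +-cong-mod (^-periodic 2 5 4 240 (same-residue refl) x) ≡-mod-refl ⟩
    2 ^ (5 + x % 4) + 1        ∎

Small : ℕ → Set
Small c = c ≤ 16

small : ∀ n → {T (n ≤ᵇ 16)} → Small n
small n {n≤16} = ≤ᵇ⇒≤ n 16 n≤16

-- Catalan-type equations between powers of 2 and 3 (the solutions are
-- 1 + 2 = 3, 1 + 8 = 9, 1 + 1 = 2 and 1 + 3 = 4).
catalan-3 : ∀ k y → 1 + 2 ^ k ≡ 3 ^ suc y → Small (3 ^ suc y)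
catalan-3 k 0 _ = small 3
catalan-3 k 1 _ = small 9
catalan-3 k (suc (suc y)) eq = ⊥-elim (1+2^k≢3^[3+y] k y eq)

catalan-2 : ∀ j x → 1 + 3 ^ j ≡ 2 ^ suc x → Small (2 ^ suc x)
catalan-2 j 0 _ = small 2
catalan-2 j 1 _ = small 4
catalan-2 j (suc (suc x)) eq = ⊥-elim (1+3^j≢2^[3+x] j x eq)

-- The equation 2^(3+p) + 3^(1+j) = 2^(1+x) + 1, i.e. (2^(3+p) - 1) + 3^(1+j) = 2^(1+x),
-- forces 2^(1+x) ≤ 16 (the one solution is 7 + 9 = 16).
mersenne-catalan : ∀ p j x → 2 ^ (3 + p) + 3 ^ suc j ≡ 2 ^ suc x + 1 → Small (2 ^ suc x)
mersenne-catalan p j 0 _ = small 2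
mersenne-catalan p j 1 _ = small 4
mersenne-catalan p j 2 _ = small 8
mersenne-catalan p j 3 _ = small 16
mersenne-catalan zero j (suc (suc (suc (suc x)))) eq = ⊥-elim (8+3^j≢2^[5+x]+1 (suc j) x eq)
mersenne-catalan (suc p) j (suc (suc (suc (suc x)))) eq = ⊥-elim (2^[4+p]+3^[1+j]≢2^[5+x]+1 p j x eq)

prime≥2 : ∀ {p} → Prime p → 2 ≤ p
prime≥2 {p} pp = nonTrivial⇒n>1 p {{prime⇒nonTrivial pp}}

prime[3] : Prime 3
prime[3] = from-yes (prime? 3)

distinct-primes-coprime : ∀ {p q} → Prime p → Prime q → p ≢ q → Coprime p q
distinct-primes-coprime pp pq p≢q (d∣p , d∣q) with prime⇒irreducible pp d∣p
... | inj₁ d≡1 = d≡1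
... | inj₂ refl with prime⇒irreducible pq d∣q
...   | inj₁ refl = ⊥-elim (¬prime[1] pp)
...   | inj₂ refl = ⊥-elim (p≢q refl)

coprime-∣⇒*∣ : ∀ {p q n} → Coprime p q → p ∣ n → q ∣ n → p * q ∣ n
coprime-∣⇒*∣ {p} {q} coprime (divides k refl) q∣kp =
  subst (p * q ∣_) (*-comm p k) (*-monoʳ-∣ p q∣k)
  where
  q∣k : q ∣ k
  q∣k = coprime-divisor (Coprime.sym coprime) (subst (q ∣_) (*-comm k p) q∣kp)

rad≢0 : ∀ n → NonZero (rad n)
rad≢0 n = productOfPrimes≢0 (All.map proj₁ (all-filter (λ p → prime? p ×-dec (p ∣? n)) (upTo (suc n))))

prime∣⇒∣rad : ∀ {p n} .{{_ : NonZero n}} → Prime p → p ∣ n → p ∣ rad n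
prime∣⇒∣rad {p} {n} pp p∣n =
  ∈⇒∣product (∈-filter⁺ (λ q → prime? q ×-dec (q ∣? n)) (∈-upTo⁺ (s≤s (∣⇒≤ p∣n))) (pp , p∣n))

∣rad⇒≤rad : ∀ {m n} → m ∣ rad n → m ≤ rad n
∣rad⇒≤rad {n = n} = ∣⇒≤ {{rad≢0 n}}

prime≤rad : ∀ {p n} .{{_ : NonZero n}} → Prime p → p ∣ n → p ≤ rad n
prime≤rad {n = n} pp p∣n = ∣rad⇒≤rad {n = n} (prime∣⇒∣rad pp p∣n)

primes*≤rad : ∀ {p q n} .{{_ : NonZero n}} → Prime p → Prime q → p ≢ q →
              p ∣ n → q ∣ n → p * q ≤ rad n
primes*≤rad {n = n} pp pq p≢q p∣n q∣n = ∣rad⇒≤rad {n = n}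
  (coprime-∣⇒*∣ (distinct-primes-coprime pp pq p≢q) (prime∣⇒∣rad pp p∣n) (prime∣⇒∣rad pq q∣n))

+≤* : ∀ {m n k} → n ≤ m → 2 ≤ k → m + n ≤ k * m
+≤* {m} {n} {k} n≤m 2≤k = begin
  m + n        ≤⟨ +-monoʳ-≤ m n≤m ⟩
  m + m        ≡⟨ cong (m +_) (+-identityʳ m) ⟨
  2 * m        ≤⟨ *-monoˡ-≤ m 2≤k ⟩
  k * m        ∎
  where open ≤-Reasoning

sum≤product : ∀ {m n} → 2 ≤ m → 2 ≤ n → m + n ≤ m * n
sum≤product {m} {n} 2≤m 2≤n with ≤-total m n
... | inj₁ m≤n = subst (_≤ m * n) (+-comm n m) (+≤* m≤n 2≤m)
... | inj₂ n≤m = subst (m + n ≤_) (*-comm n m) (+≤* n≤m 2≤n)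

NoCommonPrime : ℕ → ℕ → Set
NoCommonPrime x y = ∀ {p} → Prime p → p ∣ x → p ∣ y → ⊥

-- If a + b = c and no prime divides all three, then a, b, c are pairwise coprime:
-- a prime dividing two of them divides the third.
module _ {a b c} (coprime : Coprime3 a b c) (sum : a + b ≡ c) where

  coprime-ab : NoCommonPrime a b
  coprime-ab pp p∣a p∣b = coprime _ pp p∣a p∣b (subst (_ ∣_) sum (∣m∣n⇒∣m+n p∣a p∣b))

  coprime-ac : NoCommonPrime a c
  coprime-ac pp p∣a p∣c = coprime _ pp p∣a (∣m+n∣m⇒∣n (subst (_ ∣_) (sym sum) p∣c) p∣a) p∣c

  coprime-bc : NoCommonPrime b c
  coprime-bc pp p∣b p∣c =
    coprime _ pp (∣m+n∣m⇒∣n (subst (_ ∣_) (sym (trans (+-comm b a) sum)) p∣c) p∣b) p∣b p∣c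

2∣2^[1+k]*3^j : ∀ k j → 2 ∣ 2 ^ suc k * 3 ^ j
2∣2^[1+k]*3^j k j = ∣m⇒∣m*n (3 ^ j) (m∣m*n (2 ^ k))

3∣2^k*3^[1+j] : ∀ k j → 3 ∣ 2 ^ k * 3 ^ suc j
3∣2^k*3^[1+j] k j = ∣n⇒∣m*n (2 ^ k) (m∣m*n (3 ^ j))

harmonic-unit : ∀ {n} → Harmonic n → ¬ 2 ∣ n → ¬ 3 ∣ n → n ≡ 1
harmonic-unit (0 , 0 , refl) _ _ = refl
harmonic-unit (suc k , j , refl) 2∤n _ = ⊥-elim (2∤n (2∣2^[1+k]*3^j k j))
harmonic-unit (k , suc j , refl) _ 3∤n = ⊥-elim (3∤n (3∣2^k*3^[1+j] k j))

data CoprimeHarmonic : ℕ → ℕ → Set where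
  one-left  : ∀ {y} → CoprimeHarmonic 1 y
  one-right : ∀ {x} → CoprimeHarmonic x 1
  pow2-pow3 : ∀ k j → CoprimeHarmonic (2 ^ suc k) (3 ^ suc j)
  pow3-pow2 : ∀ j k → CoprimeHarmonic (3 ^ suc j) (2 ^ suc k)

coprime-harmonic : ∀ {x y} → Harmonic x → Harmonic y → NoCommonPrime x y → CoprimeHarmonic x y
coprime-harmonic (0 , 0 , refl) _ _ = one-left
coprime-harmonic _ (0 , 0 , refl) _ = one-right
coprime-harmonic (suc k , j , refl) (suc k′ , j′ , refl) disjoint =
  ⊥-elim (disjoint prime[2] (2∣2^[1+k]*3^j k j) (2∣2^[1+k]*3^j k′ j′))
coprime-harmonic (k , suc j , refl) (k′ , suc j′ , refl) disjoint =
  ⊥-elim (disjoint prime[3] (3∣2^k*3^[1+j] k j) (3∣2^k*3^[1+j] k′ j′))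
coprime-harmonic (suc k , 0 , refl) (0 , suc j , refl) _ =
  subst₂ CoprimeHarmonic (sym (*-identityʳ (2 ^ suc k))) (sym (*-identityˡ (3 ^ suc j))) (pow2-pow3 k j)
coprime-harmonic (0 , suc j , refl) (suc k , 0 , refl) _ =
  subst₂ CoprimeHarmonic (sym (*-identityˡ (3 ^ suc j))) (sym (*-identityʳ (2 ^ suc k))) (pow3-pow2 j k)

unit-sum : ∀ {b c} → Harmonic b → Harmonic c → NoCommonPrime b c → 1 + b ≡ c → Small c
unit-sum hb hc disjoint sum with coprime-harmonic hb hc disjoint
... | one-left      = subst Small sum (small 2)
... | one-right     = small 1
... | pow2-pow3 k y = catalan-3 (suc k) y sum
... | pow3-pow2 j x = catalan-2 (suc j) x sum

-- The abc-conjecture on H: all coprime triples have c ≤ 16. Either one of a, b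
-- is 1 (a Catalan-type equation), or a, b are a power of 2 and a power of 3,
-- and then c, coprime to both, is 1.
harmonic-triple : ∀ {a b c} → Harmonic a → Harmonic b → Harmonic c →
                  Coprime3 a b c → a + b ≡ c → Small c
harmonic-triple {c = c} ha hb hc coprime sum with coprime-harmonic ha hb (coprime-ab coprime sum)
... | one-left  = unit-sum hb hc (coprime-bc coprime sum) sum
... | one-right = unit-sum ha hc (coprime-ac coprime sum) (trans (+-comm 1 _) sum)
... | pow2-pow3 k j = subst Small (sym c≡1) (small 1)
  where
  c≡1 : c ≡ 1
  c≡1 = harmonic-unit hc (coprime-ac coprime sum prime[2] (m∣m*n (2 ^ k)))
                         (coprime-bc coprime sum prime[3] (m∣m*n (3 ^ j)))
... | pow3-pow2 j k = subst Small (sym c≡1) (small 1)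
  where
  c≡1 : c ≡ 1
  c≡1 = harmonic-unit hc (coprime-bc coprime sum prime[2] (m∣m*n (2 ^ k)))
                         (coprime-ac coprime sum prime[3] (m∣m*n (3 ^ j)))

-- Mersenne primes other than 3 (which is harmonic) have the form 2^(3+p) - 1.
LargeMersenne : ℕ → Set
LargeMersenne M = Prime M × Σ ℕ λ p → M + 1 ≡ 2 ^ (3 + p)

harmonic-or-large-mersenne : ∀ {n} → InHM n → Harmonic n ⊎ LargeMersenne n
harmonic-or-large-mersenne (inj₁ harmonic) = inj₁ harmonic
harmonic-or-large-mersenne (inj₂ (p0 , 0 , refl)) = ⊥-elim (¬prime[0] p0)
harmonic-or-large-mersenne (inj₂ (p1 , 1 , refl)) = ⊥-elim (¬prime[1] p1)
harmonic-or-large-mersenne (inj₂ (_ , 2 , refl)) = inj₁ (0 , 1 , refl)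
harmonic-or-large-mersenne (inj₂ (pM , suc (suc (suc p)) , refl)) =
  inj₂ (pM , p , m∸n+n≡m (m^n>0 2 (3 + p)))

large-mersenne≥7 : ∀ {M} p → M + 1 ≡ 2 ^ (3 + p) → 7 ≤ M
large-mersenne≥7 {M} p M+1≡2^[3+p] = ≤-pred (begin
  8             ≤⟨ *-monoʳ-≤ 8 (m^n>0 2 p) ⟩
  8 * 2 ^ p     ≡⟨ ^-distribˡ-+-* 2 3 p ⟨
  2 ^ (3 + p)   ≡⟨ M+1≡2^[3+p] ⟨
  M + 1         ≡⟨ +-comm M 1 ⟩
  suc M         ∎)
  where open ≤-Reasoning

≤7≤ : ∀ {M} → 7 ≤ M → ∀ n → {T (n ≤ᵇ 7)} → n ≤ M
≤7≤ 7≤M n {n≤7} = ≤-trans (≤ᵇ⇒≤ n 7 n≤7) 7≤M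

shift : ∀ {M P b c} → M + 1 ≡ P → M + b ≡ c → P + b ≡ c + 1
shift {M} {P} {b} {c} M+1≡P sum = begin
  P + b      ≡⟨ cong (_+ b) M+1≡P ⟨
  M + 1 + b  ≡⟨ swap-1 M b ⟩
  M + b + 1  ≡⟨ cong (_+ 1) sum ⟩
  c + 1      ∎
  where
  open ≡-Reasoning
  swap-1 : ∀ M b → M + 1 + b ≡ M + b + 1
  swap-1 = solve-∀

second-prime : ∀ {M n q b c} .{{_ : NonZero (M * b * c)}} → Prime M → Prime q → q < M →
               q ∣ c → n ≤ M → M + n ≡ c → c ≤ rad (M * b * c)
second-prime {M} {n} {q} {b} {c} pM pq q<M q∣c n≤M sum = begin
  c          ≡⟨ sum ⟨
  M + n      ≤⟨ +≤* n≤M (prime≥2 pq) ⟩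
  q * M      ≤⟨ primes*≤rad pq pM (<⇒≢ q<M) (∣n⇒∣m*n (M * b) q∣c) (∣m⇒∣m*n c (m∣m*n b)) ⟩
  rad (M * b * c) ∎
  where open ≤-Reasoning

-- M + b = c with M a Mersenne prime ≥ 7 and b, c harmonic: either c ≤ 16, or
-- c = M + 1, M + 2, M + 4 has a prime factor 2 or 3 besides M; all other
-- shapes of (b, c) lead to exponential equations without solutions.
mersenne-harmonic : ∀ {M b c} .{{_ : NonZero (M * b * c)}} → LargeMersenne M →
                    Harmonic b → Harmonic c → Coprime3 M b c → M + b ≡ c →
                    Small c ⊎ c ≤ rad (M * b * c)
mersenne-harmonic {c = c} (pM , p , M+1≡2^[3+p]) hb hc coprime sum
  with large-mersenne≥7 p M+1≡2^[3+p] | coprime-harmonic hb hc (coprime-bc coprime sum)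
... | M≥7 | one-left  = inj₂ (second-prime pM prime[2] (≤7≤ M≥7 3) 2∣c (≤7≤ M≥7 1) sum)
  where
  2∣c : 2 ∣ c
  2∣c = subst (2 ∣_) (trans (sym M+1≡2^[3+p]) sum) (m∣m*n (2 ^ (2 + p)))
... | M≥7 | one-right = inj₁ (small 1)
... | M≥7 | pow2-pow3 0 y = inj₂ (second-prime pM prime[3] (≤7≤ M≥7 4) (m∣m*n (3 ^ y)) (≤7≤ M≥7 2) sum)
... | M≥7 | pow2-pow3 1 y = inj₂ (second-prime pM prime[3] (≤7≤ M≥7 4) (m∣m*n (3 ^ y)) (≤7≤ M≥7 4) sum)
... | M≥7 | pow2-pow3 (suc (suc k)) y = ⊥-elim (2^[3+p]+2^[3+k]≢3^y+1 p k (suc y) (shift M+1≡2^[3+p] sum))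
... | M≥7 | pow3-pow2 j x = inj₁ (mersenne-catalan p j x (shift M+1≡2^[3+p] sum))

prime-sum : ∀ {a b c} .{{_ : NonZero (a * b * c)}} → Prime a → Prime b → a ≢ b →
            a + b ≡ c → c ≤ rad (a * b * c)
prime-sum {a} {b} {c} pa pb a≢b sum = begin
  c          ≡⟨ sum ⟨
  a + b      ≤⟨ sum≤product (prime≥2 pa) (prime≥2 pb) ⟩
  a * b      ≤⟨ primes*≤rad pa pb a≢b (∣m⇒∣m*n c (m∣m*n b)) (∣m⇒∣m*n c (n∣m*n a)) ⟩
  rad (a * b * c) ∎
  where open ≤-Reasoning

product≢0 : ∀ {a b c} → 0 < a → 0 < b → 0 < c → NonZero (a * b * c)
product≢0 {a} {b} {c} a>0 b>0 c>0 =
  m*n≢0 (a * b) c {{m*n≢0 a b {{>-nonZero a>0}} {{>-nonZero b>0}}}} {{>-nonZero c>0}}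

small-or-radical : ∀ {a b c} → 0 < a → 0 < b → 0 < c → Coprime3 a b c →
                   InHM a → InHM b → InHM c → a + b ≡ c → Small c ⊎ c ≤ rad (a * b * c)
small-or-radical {a} {b} {c} a>0 b>0 c>0 coprime ha hb hc sum
  with harmonic-or-large-mersenne ha | harmonic-or-large-mersenne hb | hc
... | _ | _ | inj₂ (pc , _) = inj₂ (prime≤rad {{product≢0 a>0 b>0 c>0}} pc (n∣m*n (a * b)))
... | inj₁ ha′ | inj₁ hb′ | inj₁ hc′ = inj₁ (harmonic-triple ha′ hb′ hc′ coprime sum)
... | inj₂ ma | inj₁ hb′ | inj₁ hc′ =
  mersenne-harmonic {{product≢0 a>0 b>0 c>0}} ma hb′ hc′ coprime sum
... | inj₁ ha′ | inj₂ mb | inj₁ hc′ =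
  map₂ (subst (λ n → c ≤ rad (n * c)) (*-comm b a))
       (mersenne-harmonic {{product≢0 b>0 a>0 c>0}} mb ha′ hc′ swapped (trans (+-comm b a) sum))
  where
  swapped : Coprime3 b a c
  swapped p pp p∣b p∣a p∣c = coprime p pp p∣a p∣b p∣c
... | inj₂ (pa , _) | inj₂ (pb , _) | inj₁ _ = inj₂ (prime-sum {{product≢0 a>0 b>0 c>0}} pa pb a≢b sum)
  where
  a≢b : a ≢ b
  a≢b refl = coprime-ab coprime sum pa ∣-refl ∣-refl

not-exceptional : ∀ {e d a b c} → c ≤ rad (a * b * c) → ¬ AbcExceptional e d a b c
not-exceptional {e} {d} {a} {b} {c} c≤rad exceptional = <⇒≱ exceptional (begin
  c ^ d                   ≤⟨ ^-monoˡ-≤ d c≤rad ⟩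
  rad (a * b * c) ^ d     ≤⟨ ^-monoʳ-≤ (rad (a * b * c)) {{rad≢0 (a * b * c)}} (m≤m+n d e) ⟩
  rad (a * b * c) ^ (d + e) ∎)
  where open ≤-Reasoning

smallTriples : List (ℕ × ℕ × ℕ)
smallTriples = cartesianProductWith (λ a b → (a , b , a + b)) (upTo 17) (upTo 17)

small-triple∈ : ∀ {a b c} → a + b ≡ c → Small c → (a , b , c) ∈ smallTriples
small-triple∈ {a} {b} refl a+b≤16 = ∈-cartesianProductWith⁺ (λ a b → (a , b , a + b))
  (∈-upTo⁺ (s≤s (≤-trans (m≤m+n a b) a+b≤16)))
  (∈-upTo⁺ (s≤s (≤-trans (m≤n+m b a) a+b≤16)))

corollary3p2 : (e d : ℕ) → NonZero e → NonZero d →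
    Σ (List (ℕ × ℕ × ℕ)) λ L →
      (a b c : ℕ) → 0 < a → 0 < b → 0 < c → Coprime3 a b c →
      InHM a → InHM b → InHM c → a + b ≡ c →
      AbcExceptional e d a b c → (a , b , c) ∈ L
corollary3p2 e d _ _ = smallTriples , λ a b c a>0 b>0 c>0 coprime ha hb hc sum exceptional →
  [ small-triple∈ sum , (λ c≤rad → contradiction exceptional (not-exceptional {e} {d} {a} {b} c≤rad)) ]′
    (small-or-radical a>0 b>0 c>0 coprime ha hb hc sum)
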